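{- A graph $G$ is almost bunchy if and only if for any $\Phi_1,\Phi_2\in\hom_R(G,M(G))$ there exist $\sigma\in P(G)$ and $\tau\in P(M(G))$ such that $\Phi_1=\tau\circ\Phi_2\circ\sigma$. Moreover, $G$ is bunchy if and only if for any $\Phi_1,\Phi_2\in\hom_R(G,M(G))$ there exists $\sigma\in P(G)$ with $\Phi_1=\Phi_2\circ\sigma$ (i.e. one can take $\tau=\mathrm{id}$).
   Context: All graphs are finite directed graphs with state set $V(G)$, edge set $E(G)$, source/target maps $s,t$; loops and parallel edges allowed; all graphs sink-free. $E_I(G)=s^{ -1}(I)$, $F(I)=t(E_I(G))$. A homomorphism consists of maps on edges and ($\partial\Phi$) on states commuting with $s,t$. A right-resolver is a surjective homomorphism with $\Phi|_{E_I(G)}:E_I(G)\to E_{\partial\Phi(I)}(H)$ bijective for all $I$; $\hom_R(G,H)$ the set of these, $H\leq_R G$ if nonempty. $M(G)$ is the unique (up to isomorphism) $\leq_R$-minimal graph with $M(G)\leq_R G$; all right-resolvers $G\to M(G)$ have the same state map $\Sigma_G$. $P(G)$ denotes the group of graph automorphisms of $G$ that fix every state (i.e. permute parallel edges). A state $I$ is bunchy if $\Sigma_G|_{F(I)}:F(I)\to F(\Sigma_G(I))$ is a bijection; $G$ is bunchy if all its states are. $G$ is almost bunchy if for each $I,J\in V(M(G))$ there is at most one $I'\in\Sigma_G^{ -1}(I)$ with $|F(I')\cap\Sigma_G^{ -1}(J)|\geq 2$. -}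

module Defs where

open import Data.Nat using (ℕ)
open import Data.Fin using (Fin)
open import Data.Product using (Σ; ∃; ∃-syntax; _×_; _,_)
open import Relation.Binary.PropositionalEquality using (_≡_)
open import Relation.Nullary using (¬_)

record Graph : Set where
  field
    nV : ℕ
    nE : ℕ
    src : Fin nE → Fin nV
    tgt : Fin nE → Fin nV
    sinkFree : ∀ (v : Fin nV) → ∃[ e ] (src e ≡ v)

open Graph public

V : Graph → Set
V G = Fin (nV G)

E : Graph → Set
E G = Fin (nE G)

_∈F_ : {G : Graph} → V G → V G → Set
_∈F_ {G} J I = ∃[ e ] (src G e ≡ I × tgt G e ≡ J)

record Hom (G H : Graph) : Set where
  field
    edge  : E G → E H
    state : V G → V H
    edge-src : ∀ e → src H (edge e) ≡ state (src G e)
    edge-tgt : ∀ e → tgt H (edge e) ≡ state (tgt G e)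

open Hom public

record RightResolver (G H : Graph) : Set where
  field
    hom : Hom G H
    surj-edge  : ∀ (e' : E H) → ∃[ e ] (edge hom e ≡ e')
    surj-state : ∀ (J : V H) → ∃[ I ] (state hom I ≡ J)
    local-inj  : ∀ (I : V G) (e₁ e₂ : E G) → src G e₁ ≡ I → src G e₂ ≡ I →
                 edge hom e₁ ≡ edge hom e₂ → e₁ ≡ e₂
    local-surj : ∀ (I : V G) (e' : E H) → src H e' ≡ state hom I →
                 ∃[ e ] (src G e ≡ I × edge hom e ≡ e')

open RightResolver public

_≤R_ : Graph → Graph → Set
H ≤R G = RightResolver G H

IsMinimalResolvent : Graph → Graph → Set
IsMinimalResolvent G M = (M ≤R G) × (∀ (H : Graph) → H ≤R M → M ≤R H)

-- P(G): graph automorphisms of G fixing every state (permuting parallel edges).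
record StateFixingAut (G : Graph) : Set where
  field
    perm    : E G → E G
    inv     : E G → E G
    inv-l   : ∀ e → inv (perm e) ≡ e
    inv-r   : ∀ e → perm (inv e) ≡ e
    pres-src : ∀ e → src G (perm e) ≡ src G e
    pres-tgt : ∀ e → tgt G (perm e) ≡ tgt G e

open StateFixingAut public

-- Φ₁ = τ ∘ Φ₂ ∘ σ as homomorphisms (edge maps and state maps agree);
-- σ, τ act as the identity on states.
EqComp : {G M : Graph} → RightResolver G M → StateFixingAut M →
         RightResolver G M → StateFixingAut G → Set
EqComp {G} {M} Φ₁ τ Φ₂ σ =
  (∀ (e : E G) → edge (hom Φ₁) e ≡ perm τ (edge (hom Φ₂) (perm σ e))) ×
  (∀ (I : V G) → state (hom Φ₁) I ≡ state (hom Φ₂) I)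

EqComp₁ : {G M : Graph} → RightResolver G M → RightResolver G M →
          StateFixingAut G → Set
EqComp₁ {G} {M} Φ₁ Φ₂ σ =
  (∀ (e : E G) → edge (hom Φ₁) e ≡ edge (hom Φ₂) (perm σ e)) ×
  (∀ (I : V G) → state (hom Φ₁) I ≡ state (hom Φ₂) I)

-- Bunchiness, relative to Σ_G given as the state map of a right-resolver
-- G → M(G) (all such resolvers share the same state map Σ_G).
module _ {G M : Graph} (Φ : RightResolver G M) where
  private
    Σ' : V G → V M
    Σ' = state (hom Φ)

  BunchyState : V G → Set
  BunchyState I =
    (∀ (J₁ J₂ : V G) → _∈F_ {G} J₁ I → _∈F_ {G} J₂ I → Σ' J₁ ≡ Σ' J₂ → J₁ ≡ J₂) ×
    (∀ (K : V M) → _∈F_ {M} K (Σ' I) → ∃[ J ] (_∈F_ {G} J I × Σ' J ≡ K))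

  Bunchy : Set
  Bunchy = ∀ (I : V G) → BunchyState I

  TwoInFiber : V G → V M → Set
  TwoInFiber I' J = ∃[ J₁ ] ∃[ J₂ ] (¬ (J₁ ≡ J₂) ×
    _∈F_ {G} J₁ I' × _∈F_ {G} J₂ I' × Σ' J₁ ≡ J × Σ' J₂ ≡ J)

  AlmostBunchy : Set
  AlmostBunchy = ∀ (I J : V M) (I₁ I₂ : V G) →
    Σ' I₁ ≡ I → Σ' I₂ ≡ I → TwoInFiber I₁ J → TwoInFiber I₂ J → I₁ ≡ I₂

module Submission where

-- All right-resolvers G → M share their state map Σ: the equivalence on states of M generated by
-- the pairs (Σ₁ I, Σ₂ I) is compatible with out-edges, so M resolves onto its quotient, which
-- minimality forbids from being proper. With a common Σ, two resolvers differ at each state I by a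
-- bijection of the out-edges of I, and a σ ∈ P(G) exists iff it can be chosen target-preserving.
-- At a bunchy state Σ is injective on followers, so it always can; at a non-bunchy one, swapping
-- two edges with distinct targets in one Σ-fibre gives a resolver that no σ corrects. A τ ∈ P(M)
-- may permute the edges x → y of M, which realigns the one state over x branching towards y;
-- two such states cannot both be realigned, by counting edges x → y by the targets of their lifts.

open import Defs
open import Axiom.UniquenessOfIdentityProofs using (module Decidable⇒UIP)
open import Data.Empty using (⊥; ⊥-elim)
open import Data.Fin using (Fin; zero; suc)
open import Data.Fin.Properties using (_≟_; suc-injective; injective⇒≤; any?)
open import Data.Fin.Permutation using (Permutation′; _⟨$⟩ʳ_; _⟨$⟩ˡ_; inverseˡ; inverseʳ; transpose)
import Data.Fin.Permutation.Components as PC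
open import Data.Nat using (ℕ; zero; suc; _≤_; _<_)
import Data.Nat.Properties as ℕ
open import Data.Product using (Σ; ∃; ∃₂; ∃-syntax; _×_; _,_; proj₁; proj₂)
open import Function using (_∘_; id)
open import Function.Bundles using (_⇔_; mk⇔; _↔_; Inverse; mk↔ₛ′)
open import Function.Construct.Composition using (_↔-∘_)
open import Function.Construct.Identity using (↔-id)
open import Function.Construct.Symmetry using (↔-sym)
open import Function.Definitions using (Injective)
open import Level using (0ℓ)
open import Relation.Binary using (Rel; IsEquivalence; DecidableEquality; _=[_]⇒_)
open import Relation.Binary.Construct.Closure.Equivalence using (EqClosure; return; gfold)
import Relation.Binary.Construct.Closure.Equivalence as EqClosure
open import Relation.Binary.PropositionalEquality
open import Relation.Nullary using (¬_; Dec; yes; no; contradiction)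
open import Relation.Nullary.Decidable using (_×-dec_; ¬?)
open import Relation.Unary using (Decidable)

transpose-matchʳ : ∀ {n} (i j : Fin n) → PC.transpose i j j ≡ i
transpose-matchʳ i j with j ≟ i
... | yes j≡i = j≡i
... | no _ with j ≟ j
...   | yes _ = refl
...   | no j≢j = contradiction refl j≢j

transpose-other : ∀ {n} {i j k : Fin n} → k ≢ i → k ≢ j → PC.transpose i j k ≡ k
transpose-other {i = i} {j} {k} k≢i k≢j with k ≟ i
... | yes k≡i = contradiction k≡i k≢i
... | no _ with k ≟ j
...   | yes k≡j = contradiction k≡j k≢j
...   | no _ = refl

transpose-invariant : ∀ {n} {A : Set} (f : Fin n → A) {i j : Fin n} → f i ≡ f j →
                      ∀ k → f (PC.transpose i j k) ≡ f k
transpose-invariant f {i} {j} fi≡fj k with k ≟ i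
... | yes refl = sym fi≡fj
... | no _ with k ≟ j
...   | yes refl = fi≡fj
...   | no _ = refl

surjective⇒≤ : ∀ {m n} (f : Fin m → Fin n) → (∀ y → ∃[ x ] f x ≡ y) → n ≤ m
surjective⇒≤ f surj = injective⇒≤ section-injective
  where
  section-injective : Injective _≡_ _≡_ (proj₁ ∘ surj)
  section-injective {y} {y′} eq =
    trans (sym (proj₂ (surj y))) (trans (cong f eq) (proj₂ (surj y′)))

-- An injection Fin m → Fin n missing a point extends injectively to Fin (suc m).
missing⇒< : ∀ {m n} (f : Fin m → Fin n) → Injective _≡_ _≡_ f →
            (c : Fin n) → (∀ i → f i ≢ c) → m < n
missing⇒< {m} f f-inj c c∉f = injective⇒≤ extended-injective
  where
  extended : Fin (suc m) → Fin _
  extended zero = c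
  extended (suc i) = f i
  extended-injective : Injective _≡_ _≡_ extended
  extended-injective {zero}  {zero}  _ = refl
  extended-injective {zero}  {suc j} eq = contradiction (sym eq) (c∉f j)
  extended-injective {suc i} {zero}  eq = contradiction eq (c∉f i)
  extended-injective {suc i} {suc j} eq = cong suc (f-inj eq)

record Enumeration {n : ℕ} (P : Fin n → Set) : Set where
  field
    size              : ℕ
    element           : Fin size → Fin n
    element-P         : ∀ i → P (element i)
    element-injective : Injective _≡_ _≡_ element
    index             : ∀ x → P x → Fin size
    element-index     : ∀ x p → element (index x p) ≡ x

  index-cong : ∀ {x y} p q → x ≡ y → index x p ≡ index y q
  index-cong p q refl = element-injective (trans (element-index _ p) (sym (element-index _ q)))

  index-injective : ∀ {x y} p q → index x p ≡ index y q → x ≡ y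
  index-injective {x} {y} p q eq =
    trans (sym (element-index x p)) (trans (cong element eq) (element-index y q))

  index-element : ∀ i p → index (element i) p ≡ i
  index-element i p = element-injective (element-index (element i) p)

  size< : ∀ x → ¬ P x → size < n
  size< x ¬Px = missing⇒< element element-injective x
    (λ i eq → ¬Px (subst P eq (element-P i)))

module _ {n : ℕ} {P : Fin (suc n) → Set} (rest : Enumeration (P ∘ suc)) where
  open Enumeration rest

  enumeration-∷ : P zero → Enumeration P
  enumeration-∷ P0 = record
    { size = suc size ; element = element′ ; element-P = element′-P
    ; element-injective = element′-injective ; index = index′ ; element-index = element′-index }
    where
    element′ : Fin (suc size) → Fin (suc n)
    element′ zero = zero
    element′ (suc i) = suc (element i)
    element′-P : ∀ i → P (element′ i)
    element′-P zero = P0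
    element′-P (suc i) = element-P i
    element′-injective : Injective _≡_ _≡_ element′
    element′-injective {zero}  {zero}  _ = refl
    element′-injective {suc i} {suc j} eq = cong suc (element-injective (suc-injective eq))
    index′ : ∀ x → P x → Fin (suc size)
    index′ zero _ = zero
    index′ (suc x) p = suc (index x p)
    element′-index : ∀ x p → element′ (index′ x p) ≡ x
    element′-index zero _ = refl
    element′-index (suc x) p = cong suc (element-index x p)

  enumeration-skip : ¬ P zero → Enumeration P
  enumeration-skip ¬P0 = record
    { size = size ; element = suc ∘ element ; element-P = element-P
    ; element-injective = element-injective ∘ suc-injective ; index = index′ ; element-index = element′-index }
    where
    index′ : ∀ x → P x → Fin size
    index′ zero p = contradiction p ¬P0
    index′ (suc x) p = index x p
    element′-index : ∀ x p → suc (element (index′ x p)) ≡ x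
    element′-index zero p = contradiction p ¬P0
    element′-index (suc x) p = cong suc (element-index x p)

enumerate : ∀ {n} {P : Fin n → Set} → Decidable P → Enumeration P
enumerate {zero} P? = record
  { size = 0 ; element = λ () ; element-P = λ () ; element-injective = λ { {()} }
  ; index = λ () ; element-index = λ () }
enumerate {suc n} P? with P? zero
... | yes P0 = enumeration-∷ (enumerate (P? ∘ suc)) P0
... | no ¬P0 = enumeration-skip (enumerate (P? ∘ suc)) ¬P0

-- Count the points of Z: g would inject Z ∪ {x} into Z.
invariant⇒backward-invariant : ∀ {n} {Z : Fin n → Set} → Decidable Z →
  (g : Fin n → Fin n) → Injective _≡_ _≡_ g → (∀ x → Z x → Z (g x)) → ∀ x → Z (g x) → Z x
invariant⇒backward-invariant {Z = Z} Z? g g-inj g-Z x Zgx with Z? x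
... | yes Zx = Zx
... | no ¬Zx = contradiction (injective⇒≤ h-injective) ℕ.1+n≰n
  where
  open Enumeration (enumerate Z?)
  h : Fin (suc size) → Fin size
  h zero = index (g x) Zgx
  h (suc i) = index (g (element i)) (g-Z _ (element-P i))
  h-injective : Injective _≡_ _≡_ h
  h-injective {zero}  {zero}  _ = refl
  h-injective {zero}  {suc j} eq =
    contradiction (subst Z (sym (g-inj (index-injective _ _ eq))) (element-P j)) ¬Zx
  h-injective {suc i} {zero}  eq =
    contradiction (subst Z (g-inj (index-injective _ _ eq)) (element-P i)) ¬Zx
  h-injective {suc i} {suc j} eq = cong suc (element-injective (g-inj (index-injective _ _ eq)))

Separating : {A B : Set} → (A → Set) → (A → B) → A → A → Set
Separating S β a b = S a × S b × β a ≢ β b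

module _ {A B : Set} (_≟B_ : DecidableEquality B) (S : A → Set) (β₁ β₂ : A → B) where

  private
    pairWith : ∀ {m₁ m₂} → Separating S β₁ m₁ m₂ → β₂ m₁ ≡ β₂ m₂ → ∀ c → S c → β₂ c ≢ β₂ m₁ →
               ∃₂ λ a b → Separating S β₁ a b × β₂ a ≢ β₂ b
    pairWith {m₁} {m₂} (s₁ , s₂ , m₁≢m₂) β₂-agree c sc c-off with β₁ c ≟B β₁ m₁
    ... | no c≢m₁ = c , m₁ , (sc , s₁ , c≢m₁) , c-off
    ... | yes c≡m₁ = c , m₂ , (sc , s₂ , m₁≢m₂ ∘ trans (sym c≡m₁))
                   , c-off ∘ (λ e → trans e (sym β₂-agree))

  separatingBoth : ∃₂ (Separating S β₁) → ∃₂ (Separating S β₂) →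
                   ∃₂ λ a b → Separating S β₁ a b × β₂ a ≢ β₂ b
  separatingBoth (m₁ , m₂ , sep₁) (n₁ , n₂ , t₁ , t₂ , n₁≢n₂) with β₂ m₁ ≟B β₂ m₂
  ... | no β₂-differ = m₁ , m₂ , sep₁ , β₂-differ
  ... | yes β₂-agree with β₂ n₁ ≟B β₂ m₁
  ...   | no n₁-off = pairWith sep₁ β₂-agree n₁ t₁ n₁-off
  ...   | yes n₁-on = pairWith sep₁ β₂-agree n₂ t₂ (n₁≢n₂ ∘ trans n₁-on ∘ sym)

merge : ∀ {n} → Fin n → Fin n → Fin n → Fin n
merge a b v with v ≟ b
... | yes _ = a
... | no _ = v

merge-target : ∀ {n} (a b : Fin n) → merge a b b ≡ a
merge-target a b with b ≟ b
... | yes _ = refl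
... | no b≢b = contradiction refl b≢b

merge-source : ∀ {n} (a b : Fin n) → merge a b a ≡ a
merge-source a b with a ≟ b
... | yes _ = refl
... | no _ = refl

module _ {n ℓ} {_~_ : Rel (Fin n) ℓ} (~-equiv : IsEquivalence _~_) where
  open IsEquivalence ~-equiv using () renaming (refl to ~-refl; sym to ~-sym; trans to ~-trans)

  coequaliser : ∀ {k} (f g : Fin k → Fin n) → (∀ i → f i ~ g i) →
                ∃ λ (r : Fin n → Fin n) → (∀ x → x ~ r x) × (∀ i → r (f i) ≡ r (g i))
  coequaliser {zero} f g _ = id , (λ _ → ~-refl) , λ ()
  coequaliser {suc k} f g f~g with coequaliser (f ∘ suc) (g ∘ suc) (f~g ∘ suc)
  ... | r , r~ , r-coeq = merge a b ∘ r , merged~ , merged-coeq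
    where
    a = r (f zero)
    b = r (g zero)
    b~a : b ~ a
    b~a = ~-trans (~-sym (r~ (g zero))) (~-trans (~-sym (f~g zero)) (r~ (f zero)))
    merged~ : ∀ x → x ~ merge a b (r x)
    merged~ x with r x ≟ b
    ... | yes rx≡b = ~-trans (r~ x) (subst (_~ a) (sym rx≡b) b~a)
    ... | no _ = r~ x
    merged-coeq : ∀ i → merge a b (r (f i)) ≡ merge a b (r (g i))
    merged-coeq zero = trans (merge-source a b) (sym (merge-target a b))
    merged-coeq (suc i) = cong (merge a b) (r-coeq i)

data Generated {k n : ℕ} (f g : Fin k → Fin n) : Rel (Fin n) 0ℓ where
  generator : ∀ i → Generated f g (f i) (g i)

canonicalForm : ∀ {k n} (f g : Fin k → Fin n) → let _~_ = EqClosure (Generated f g) in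
                ∃ λ (r : Fin n → Fin n) → (∀ x → x ~ r x) × _~_ =[ r ]⇒ _≡_
canonicalForm f g with coequaliser (EqClosure.isEquivalence (Generated f g)) f g (return ∘ generator)
... | r , r~ , r-coeq = r , r~ , gfold isEquivalence r λ { (generator i) → r-coeq i }

module _ {G M : Graph} (Φ : RightResolver G M) where

  lift : (I : V G) (m : E M) → src M m ≡ state (hom Φ) I → E G
  lift I m p = proj₁ (local-surj Φ I m p)

  lift-src : ∀ I m p → src G (lift I m p) ≡ I
  lift-src I m p = proj₁ (proj₂ (local-surj Φ I m p))

  lift-edge : ∀ I m p → edge (hom Φ) (lift I m p) ≡ m
  lift-edge I m p = proj₂ (proj₂ (local-surj Φ I m p))

  lift-unique : ∀ {I e} → src G e ≡ I → ∀ p → lift I (edge (hom Φ) e) p ≡ e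
  lift-unique {I} {e} se p = local-inj Φ I _ e (lift-src I _ p) se (lift-edge I _ p)

≤R⇒nV≤ : ∀ {G H} → H ≤R G → nV H ≤ nV G
≤R⇒nV≤ Φ = surjective⇒≤ (state (hom Φ)) (surj-state Φ)

Out : (G : Graph) → V G → Set
Out G I = Σ (E G) λ e → src G e ≡ I

Out-≡ : ∀ {G} {I} {o o′ : Out G I} → proj₁ o ≡ proj₁ o′ → o ≡ o′
Out-≡ {o = e , p} {.e , q} refl = cong (e ,_) (≡-irrelevant p q)
  where open Decidable⇒UIP _≟_

outBijection : ∀ {G M} (Φ : RightResolver G M) I → Out G I ↔ Out M (state (hom Φ) I)
outBijection {G} {M} Φ I = mk↔ₛ′ to from
  (λ { (m , q) → Out-≡ {M} (lift-edge Φ I m q) })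
  (λ { (e , p) → Out-≡ {G} (lift-unique Φ p _) })
  where
  to : Out G I → Out M (state (hom Φ) I)
  to (e , p) = edge (hom Φ) e , trans (edge-src (hom Φ) e) (cong (state (hom Φ)) p)
  from : Out M (state (hom Φ) I) → Out G I
  from (m , q) = lift Φ I m q , lift-src Φ I m q

precompose : ∀ {G M} (Φ : RightResolver G M) (π : Permutation′ (nE G)) →
  (∀ e → src G (π ⟨$⟩ʳ e) ≡ src G e) →
  (∀ e → state (hom Φ) (tgt G (π ⟨$⟩ʳ e)) ≡ state (hom Φ) (tgt G e)) → RightResolver G M
precompose {G} Φ π π-src π-tgt = record
  { hom = record
    { edge = edge (hom Φ) ∘ (π ⟨$⟩ʳ_)
    ; state = state (hom Φ)
    ; edge-src = λ e → trans (edge-src (hom Φ) (π ⟨$⟩ʳ e)) (cong (state (hom Φ)) (π-src e))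
    ; edge-tgt = λ e → trans (edge-tgt (hom Φ) (π ⟨$⟩ʳ e)) (π-tgt e) }
  ; surj-edge = λ m → let (e , Φe≡m) = surj-edge Φ m in
      π ⟨$⟩ˡ e , trans (cong (edge (hom Φ)) (inverseʳ π)) Φe≡m
  ; surj-state = surj-state Φ
  ; local-inj = λ I e₁ e₂ p₁ p₂ eq → trans (sym (inverseˡ π))
      (trans (cong (π ⟨$⟩ˡ_) (local-inj Φ I _ _ (trans (π-src e₁) p₁) (trans (π-src e₂) p₂) eq)) (inverseˡ π))
  ; local-surj = λ I m p → let (e , se , Φe≡m) = local-surj Φ I m p in
      π ⟨$⟩ˡ e , trans (sym (π-src (π ⟨$⟩ˡ e))) (trans (cong (src G) (inverseʳ π)) se)
               , trans (cong (edge (hom Φ)) (inverseʳ π)) Φe≡m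
  }

swapEdges : ∀ {G M} (Φ : RightResolver G M) (a b : E G) → src G a ≡ src G b →
  state (hom Φ) (tgt G a) ≡ state (hom Φ) (tgt G b) → RightResolver G M
swapEdges {G} Φ a b same-src same-tgt = precompose Φ (transpose a b)
  (transpose-invariant (src G) same-src) (transpose-invariant (state (hom Φ) ∘ tgt G) same-tgt)

module _ {G : Graph} (σ : StateFixingAut G) where

  perm-injective : Injective _≡_ _≡_ (perm σ)
  perm-injective {e} {e′} eq = trans (sym (inv-l σ e)) (trans (cong (inv σ) eq) (inv-l σ e′))

  P-inverse : StateFixingAut G
  P-inverse = record
    { perm = inv σ ; inv = perm σ ; inv-l = inv-r σ ; inv-r = inv-l σ
    ; pres-src = λ e → trans (sym (pres-src σ (inv σ e))) (cong (src G) (inv-r σ e))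
    ; pres-tgt = λ e → trans (sym (pres-tgt σ (inv σ e))) (cong (tgt G) (inv-r σ e)) }

record OutMatching (M : Graph) (_~_ : Rel (V M) 0ℓ) (x y : V M) : Set where
  field
    bijection   : Out M x ↔ Out M y
    tgt-related : ∀ o → tgt M (proj₁ (Inverse.to bijection o)) ~ tgt M (proj₁ o)

module _ {M : Graph} {_~_ : Rel (V M) 0ℓ} (~-equiv : IsEquivalence _~_) where
  open IsEquivalence ~-equiv using () renaming (refl to ~-refl; sym to ~-sym; trans to ~-trans)
  open OutMatching

  outMatching-isEquivalence : IsEquivalence (OutMatching M _~_)
  outMatching-isEquivalence = record
    { refl = record { bijection = ↔-id _ ; tgt-related = λ _ → ~-refl }
    ; sym = λ T → record
      { bijection = ↔-sym (bijection T)
      ; tgt-related = λ o → ~-sym (subst (λ o′ → tgt M (proj₁ o′) ~ _)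
          (Inverse.strictlyInverseˡ (bijection T) o) (tgt-related T (Inverse.from (bijection T) o))) }
    ; trans = λ T S → record
      { bijection = bijection S ↔-∘ bijection T
      ; tgt-related = λ o → ~-trans (tgt-related S _) (tgt-related T o) }
    }

-- r chooses a representative of each ~-class; these are the states of the quotient.
module Quotient {M : Graph} {_~_ : Rel (V M) 0ℓ}
  (match : ∀ {x y} → x ~ y → OutMatching M _~_ x y)
  (r : V M → V M) (r~ : ∀ x → x ~ r x) (r-resp : _~_ =[ r ]⇒ _≡_) where

  private
    r-idempotent : ∀ x → r (r x) ≡ r x
    r-idempotent x = sym (r-resp (r~ x))

    module St = Enumeration (enumerate (λ x → r x ≟ x))
    module Ed = Enumeration (enumerate (λ e → r (src M e) ≟ src M e))

    src′ : Fin Ed.size → Fin St.size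
    src′ h = St.index (src M (Ed.element h)) (Ed.element-P h)

    class : V M → Fin St.size
    class x = St.index (r x) (r-idempotent x)

    transfer : ∀ x → Out M x ↔ Out M (r x)
    transfer x = OutMatching.bijection (match (r~ x))

    shift : E M → E M
    shift e = proj₁ (Inverse.to (transfer (src M e)) (e , refl))

    shift-at : ∀ {x e} (p : src M e ≡ x) → shift e ≡ proj₁ (Inverse.to (transfer x) (e , p))
    shift-at refl = refl

    shift-src : ∀ e → src M (shift e) ≡ r (src M e)
    shift-src e = proj₂ (Inverse.to (transfer (src M e)) (e , refl))

    shift-fixed : ∀ e → r (src M (shift e)) ≡ src M (shift e)
    shift-fixed e = trans (cong r (shift-src e)) (trans (r-idempotent _) (sym (shift-src e)))

    shift-injective : ∀ {x e₁ e₂} → src M e₁ ≡ x → src M e₂ ≡ x → shift e₁ ≡ shift e₂ → e₁ ≡ e₂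
    shift-injective {x} p₁ p₂ eq = cong proj₁ (trans (sym (strictlyInverseʳ _))
      (trans (cong from (Out-≡ {M} (trans (sym (shift-at p₁)) (trans eq (shift-at p₂)))))
             (strictlyInverseʳ _)))
      where open Inverse (transfer x)

    edge′ : E M → Fin Ed.size
    edge′ e = Ed.index (shift e) (shift-fixed e)

    unshift : ∀ x h → src M (Ed.element h) ≡ r x → ∃[ e ] (src M e ≡ x × edge′ e ≡ h)
    unshift x h p =
      e , se , trans (Ed.index-cong (shift-fixed e) (Ed.element-P h) shift-e) (Ed.index-element h _)
      where
      e = proj₁ (Inverse.from (transfer x) (Ed.element h , p))
      se = proj₂ (Inverse.from (transfer x) (Ed.element h , p))
      shift-e : shift e ≡ Ed.element h
      shift-e = trans (shift-at se) (cong proj₁ (Inverse.strictlyInverseˡ (transfer x) _))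

  quotient : Graph
  quotient = record
    { nV = St.size ; nE = Ed.size ; src = src′
    ; tgt = λ h → class (tgt M (Ed.element h))
    ; sinkFree = λ c →
        let x = St.element c
            (e , se) = sinkFree M x
            e-fixed = trans (cong r se) (trans (St.element-P c) (sym se))
        in Ed.index e e-fixed
         , trans (St.index-cong _ (St.element-P c) (trans (cong (src M) (Ed.element-index e e-fixed)) se))
                 (St.index-element c _) }

  quotientResolver : RightResolver M quotient
  quotientResolver = record
    { hom = record
      { edge = edge′ ; state = class
      ; edge-src = λ e → St.index-cong _ _ (trans (cong (src M) (Ed.element-index _ _)) (shift-src e))
      ; edge-tgt = λ e → St.index-cong _ _ (trans (cong (r ∘ tgt M) (Ed.element-index _ _))
          (r-resp (OutMatching.tgt-related (match (r~ (src M e))) (e , refl)))) }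
    ; surj-edge = λ h → let (e , _ , e↦h) = unshift _ h (sym (Ed.element-P h)) in e , e↦h
    ; surj-state = λ c → St.element c
        , trans (St.index-cong _ (St.element-P c) (St.element-P c)) (St.index-element c _)
    ; local-inj = λ x e₁ e₂ p₁ p₂ eq → shift-injective p₁ p₂ (Ed.index-injective _ _ eq)
    ; local-surj = λ x h p → unshift x h (St.index-injective _ _ p)
    }

  quotient-smaller : ∀ x → r x ≢ x → nV quotient < nV M
  quotient-smaller = St.size<

minimal⇒unique-stateMap : ∀ {G M} → (∀ H → H ≤R M → M ≤R H) →
  (Φ₁ Φ₂ : RightResolver G M) → state (hom Φ₁) ≗ state (hom Φ₂)
minimal⇒unique-stateMap {G} {M} minimal Φ₁ Φ₂ I =
  trans (sym (r-id (Σ₁ I))) (trans (r-resp (return (generator I))) (r-id (Σ₂ I)))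
  where
  Σ₁ = state (hom Φ₁)
  Σ₂ = state (hom Φ₂)
  _~_ = EqClosure (Generated Σ₁ Σ₂)
  ~-equiv = EqClosure.isEquivalence (Generated Σ₁ Σ₂)

  resolverMatching : ∀ {x y} → Generated Σ₁ Σ₂ x y → OutMatching M _~_ x y
  resolverMatching (generator I) = record
    { bijection = outBijection Φ₂ I ↔-∘ ↔-sym (outBijection Φ₁ I)
    ; tgt-related = λ { (m , q) → let ℓ = lift Φ₁ I m q in
        subst₂ _~_ (sym (edge-tgt (hom Φ₂) ℓ))
                   (trans (sym (edge-tgt (hom Φ₁) ℓ)) (cong (tgt M) (lift-edge Φ₁ I m q)))
                   (IsEquivalence.sym ~-equiv (return (generator (tgt G ℓ)))) } }

  r = proj₁ (canonicalForm Σ₁ Σ₂)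
  r~ = proj₁ (proj₂ (canonicalForm Σ₁ Σ₂))
  r-resp = proj₂ (proj₂ (canonicalForm Σ₁ Σ₂))
  open Quotient (EqClosure.fold (outMatching-isEquivalence ~-equiv) resolverMatching) r r~ r-resp

  r-id : ∀ x → r x ≡ x
  r-id x with r x ≟ x
  ... | yes rx≡x = rx≡x
  ... | no rx≢x = contradiction (≤R⇒nV≤ (minimal quotient quotientResolver))
                                (ℕ.<⇒≱ (quotient-smaller x rx≢x))

record OutBijective (G M : Graph) (Σ′ : V G → V M) (ψ : E G → E M) : Set where
  field
    src-commutes   : ∀ e → src M (ψ e) ≡ Σ′ (src G e)
    out-injective  : ∀ {e₁ e₂} → src G e₁ ≡ src G e₂ → ψ e₁ ≡ ψ e₂ → e₁ ≡ e₂
    out-surjective : ∀ I m → src M m ≡ Σ′ I → ∃[ e ] (src G e ≡ I × ψ e ≡ m)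

open OutBijective

module _ {G M : Graph} where

  resolver-outBijective : (Φ : RightResolver G M) → OutBijective G M (state (hom Φ)) (edge (hom Φ))
  resolver-outBijective Φ = record
    { src-commutes = edge-src (hom Φ)
    ; out-injective = λ same-src eq → local-inj Φ _ _ _ same-src refl eq
    ; out-surjective = local-surj Φ }

  outBijective-resp : ∀ {Σ₁ Σ₂ ψ} → Σ₁ ≗ Σ₂ → OutBijective G M Σ₁ ψ → OutBijective G M Σ₂ ψ
  outBijective-resp Σ₁≗Σ₂ B = record
    { src-commutes = λ e → trans (src-commutes B e) (Σ₁≗Σ₂ _)
    ; out-injective = out-injective B
    ; out-surjective = λ I m p → out-surjective B I m (trans p (sym (Σ₁≗Σ₂ I))) }

  outBijective-aut : ∀ {Σ′ ψ} (τ : StateFixingAut M) →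
                     OutBijective G M Σ′ ψ → OutBijective G M Σ′ (perm τ ∘ ψ)
  outBijective-aut τ B = record
    { src-commutes = λ e → trans (pres-src τ _) (src-commutes B e)
    ; out-injective = λ same-src eq → out-injective B same-src (perm-injective τ eq)
    ; out-surjective = λ I m p →
        let (e , se , ψe≡) = out-surjective B I (inv τ m) (trans (pres-src (P-inverse τ) m) p)
        in e , se , trans (cong (perm τ) ψe≡) (inv-r τ m) }

  module _ {Σ′ : V G → V M} {ψ χ : E G → E M}
           (Bψ : OutBijective G M Σ′ ψ) (Bχ : OutBijective G M Σ′ χ) where

    realign : E G → E G
    realign e = proj₁ (out-surjective Bψ (src G e) (χ e) (src-commutes Bχ e))

    realign-src : ∀ e → src G (realign e) ≡ src G e
    realign-src e = proj₁ (proj₂ (out-surjective Bψ (src G e) (χ e) (src-commutes Bχ e)))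

    realign-edge : ∀ e → ψ (realign e) ≡ χ e
    realign-edge e = proj₂ (proj₂ (out-surjective Bψ (src G e) (χ e) (src-commutes Bχ e)))

  realign-inverse : ∀ {Σ′ ψ χ} (Bψ : OutBijective G M Σ′ ψ) (Bχ : OutBijective G M Σ′ χ) e →
                    realign Bχ Bψ (realign Bψ Bχ e) ≡ e
  realign-inverse Bψ Bχ e = out-injective Bχ
    (trans (realign-src Bχ Bψ _) (realign-src Bψ Bχ e))
    (trans (realign-edge Bχ Bψ _) (realign-edge Bψ Bχ e))

  P-factor : ∀ {Σ′ ψ φ} → OutBijective G M Σ′ ψ → OutBijective G M Σ′ φ →
    (∀ {e e′} → src G e′ ≡ src G e → ψ e′ ≡ φ e → tgt G e′ ≡ tgt G e) →
    ∃[ σ ] (∀ e → φ e ≡ ψ (perm σ e))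
  P-factor Bψ Bφ targets-match = σ , λ e → sym (realign-edge Bψ Bφ e)
    where
    σ : StateFixingAut G
    σ = record
      { perm = realign Bψ Bφ ; inv = realign Bφ Bψ
      ; inv-l = realign-inverse Bψ Bφ ; inv-r = realign-inverse Bφ Bψ
      ; pres-src = realign-src Bψ Bφ
      ; pres-tgt = λ e → targets-match (realign-src Bψ Bφ e) (realign-edge Bψ Bφ e) }

module _ {G M : Graph} (Φ₀ : RightResolver G M) where
  private
    Σ₀ = state (hom Φ₀)

  edge-tgt-over : (Φ : RightResolver G M) → state (hom Φ) ≗ Σ₀ →
                  ∀ e → tgt M (edge (hom Φ) e) ≡ Σ₀ (tgt G e)
  edge-tgt-over Φ Φ≗ e = trans (edge-tgt (hom Φ) e) (Φ≗ _)

  followers-onto : ∀ I K → _∈F_ {M} K (Σ₀ I) → ∃[ J ] (_∈F_ {G} J I × Σ₀ J ≡ K)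
  followers-onto I K (m , sm , tm) =
    tgt G e , (e , se , refl) , trans (sym (edge-tgt (hom Φ₀) e)) (trans (cong (tgt M) Φe≡m) tm)
    where
    e = lift Φ₀ I m sm
    se = lift-src Φ₀ I m sm
    Φe≡m = lift-edge Φ₀ I m sm

  bunchy⇒factorisation : Bunchy Φ₀ → (Φ₁ Φ₂ : RightResolver G M) →
    state (hom Φ₁) ≗ Σ₀ → state (hom Φ₂) ≗ Σ₀ → ∃[ σ ] EqComp₁ Φ₁ Φ₂ σ
  bunchy⇒factorisation bunchy Φ₁ Φ₂ Φ₁≗ Φ₂≗ =
    σ , Φ₁≡Φ₂σ , λ I → trans (Φ₁≗ I) (sym (Φ₂≗ I))
    where
    targets-match : ∀ {e e′} → src G e′ ≡ src G e → edge (hom Φ₂) e′ ≡ edge (hom Φ₁) e → tgt G e′ ≡ tgt G e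
    targets-match {e} {e′} same-src eq = proj₁ (bunchy (src G e)) _ _ (e′ , same-src , refl) (e , refl , refl)
      (trans (sym (edge-tgt-over Φ₂ Φ₂≗ e′)) (trans (cong (tgt M) eq) (edge-tgt-over Φ₁ Φ₁≗ e)))
    factorisation = P-factor (outBijective-resp Φ₂≗ (resolver-outBijective Φ₂))
                             (outBijective-resp Φ₁≗ (resolver-outBijective Φ₁)) targets-match
    σ = proj₁ factorisation
    Φ₁≡Φ₂σ = proj₂ factorisation

  factorisation⇒bunchy : (∀ (Φ₁ Φ₂ : RightResolver G M) → ∃[ σ ] EqComp₁ Φ₁ Φ₂ σ) → Bunchy Φ₀
  factorisation⇒bunchy factor I = followers-injective , followers-onto I
    where
    -- Swapping two edges out of I with Σ₀-equal targets gives a resolver; σ must undo the swap.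
    followers-injective : ∀ J₁ J₂ → _∈F_ {G} J₁ I → _∈F_ {G} J₂ I → Σ₀ J₁ ≡ Σ₀ J₂ → J₁ ≡ J₂
    followers-injective J₁ J₂ (a , sa , ta) (b , sb , tb) ΣJ₁≡ΣJ₂ =
      trans (sym ta) (trans (cong (tgt G) a≡σb) (trans (pres-tgt σ b) tb))
      where
      swapped = swapEdges Φ₀ a b (trans sa (sym sb))
                  (trans (cong Σ₀ ta) (trans ΣJ₁≡ΣJ₂ (cong Σ₀ (sym tb))))
      σ = proj₁ (factor swapped Φ₀)
      a≡σb : a ≡ perm σ b
      a≡σb = local-inj Φ₀ I a (perm σ b) sa (trans (pres-src σ b) sb)
        (trans (cong (edge (hom Φ₀)) (sym (transpose-matchʳ a b)))
               (proj₁ (proj₂ (factor swapped Φ₀)) b))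

  _∈F?_ : ∀ (J I : V G) → Dec (_∈F_ {G} J I)
  J ∈F? I = any? λ e → (src G e ≟ I) ×-dec (tgt G e ≟ J)

  twoInFiber? : ∀ K y → Dec (TwoInFiber Φ₀ K y)
  twoInFiber? K y = any? λ J₁ → any? λ J₂ →
    ¬? (J₁ ≟ J₂) ×-dec (J₁ ∈F? K) ×-dec (J₂ ∈F? K) ×-dec (Σ₀ J₁ ≟ y) ×-dec (Σ₀ J₂ ≟ y)

  Branching : V M → V M → Set
  Branching x y = ∃[ K ] (Σ₀ K ≡ x × TwoInFiber Φ₀ K y)

  branching? : ∀ x y → Dec (Branching x y)
  branching? x y = any? λ K → (Σ₀ K ≟ x) ×-dec twoInFiber? K y

  -- An edge x → y with Branching x y is re-routed from B to A through the branching state over x,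
  -- which almost bunchiness makes unique; all other edges are fixed.
  module Exchange (almostBunchy : AlmostBunchy Φ₀) (A B : RightResolver G M)
                  (A≗ : state (hom A) ≗ Σ₀) (B≗ : state (hom B) ≗ Σ₀) where

    exchange : E M → E M
    exchange m with branching? (src M m) (tgt M m)
    ... | yes (K , ΣK , _) = edge (hom A) (lift B K m (trans (sym ΣK) (sym (B≗ K))))
    ... | no _ = m

    exchange-src : ∀ m → src M (exchange m) ≡ src M m
    exchange-src m with branching? (src M m) (tgt M m)
    ... | yes (K , ΣK , _) = trans (edge-src (hom A) _)
          (trans (cong (state (hom A)) (lift-src B K m _)) (trans (A≗ K) ΣK))
    ... | no _ = refl

    tgt-transfer : ∀ e → tgt M (edge (hom A) e) ≡ tgt M (edge (hom B) e)
    tgt-transfer e = trans (edge-tgt-over A A≗ e) (sym (edge-tgt-over B B≗ e))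

    exchange-tgt : ∀ m → tgt M (exchange m) ≡ tgt M m
    exchange-tgt m with branching? (src M m) (tgt M m)
    ... | yes (K , ΣK , _) = trans (tgt-transfer _) (cong (tgt M) (lift-edge B K m _))
    ... | no _ = refl

    exchange-on : ∀ e → TwoInFiber Φ₀ (src G e) (tgt M (edge (hom B) e)) →
                  exchange (edge (hom B) e) ≡ edge (hom A) e
    exchange-on e two with branching? (src M (edge (hom B) e)) (tgt M (edge (hom B) e))
    ... | yes (K , ΣK , twoK) = cong (edge (hom A)) (lift-unique B (sym K≡src) _)
      where
      K≡src : K ≡ src G e
      K≡src = almostBunchy _ _ K (src G e) ΣK (sym Σsrc) twoK two
        where Σsrc = trans (edge-src (hom B) e) (B≗ _)
    ... | no ¬branching =
      contradiction (src G e , sym (trans (edge-src (hom B) e) (B≗ _)) , two) ¬branching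

  exchange-inverse : ∀ almostBunchy A B A≗ B≗ m →
    Exchange.exchange almostBunchy B A B≗ A≗ (Exchange.exchange almostBunchy A B A≗ B≗ m) ≡ m
  exchange-inverse almostBunchy A B A≗ B≗ m with branching? (src M m) (tgt M m)
  ... | yes (K , ΣK , twoK) =
        trans (Exchange.exchange-on almostBunchy B A B≗ A≗ ℓ two) (lift-edge B K m _)
    where
    ℓ = lift B K m (trans (sym ΣK) (sym (B≗ K)))
    two : TwoInFiber Φ₀ (src G ℓ) (tgt M (edge (hom A) ℓ))
    two = subst₂ (TwoInFiber Φ₀) (sym (lift-src B K m _))
            (sym (trans (Exchange.tgt-transfer almostBunchy A B A≗ B≗ ℓ) (cong (tgt M) (lift-edge B K m _))))
            twoK
  ... | no ¬branching with branching? (src M m) (tgt M m)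
  ...   | yes branching = contradiction branching ¬branching
  ...   | no _ = refl

  almostBunchy⇒factorisation : AlmostBunchy Φ₀ → (Φ₁ Φ₂ : RightResolver G M) →
    state (hom Φ₁) ≗ Σ₀ → state (hom Φ₂) ≗ Σ₀ → ∃[ σ ] ∃[ τ ] EqComp Φ₁ τ Φ₂ σ
  almostBunchy⇒factorisation almostBunchy Φ₁ Φ₂ Φ₁≗ Φ₂≗ =
    proj₁ factorisation , τ , proj₂ factorisation , λ I → trans (Φ₁≗ I) (sym (Φ₂≗ I))
    where
    module X = Exchange almostBunchy Φ₁ Φ₂ Φ₁≗ Φ₂≗
    τ : StateFixingAut M
    τ = record
      { perm = X.exchange ; inv = Exchange.exchange almostBunchy Φ₂ Φ₁ Φ₂≗ Φ₁≗
      ; inv-l = exchange-inverse almostBunchy Φ₁ Φ₂ Φ₁≗ Φ₂≗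
      ; inv-r = exchange-inverse almostBunchy Φ₂ Φ₁ Φ₂≗ Φ₁≗
      ; pres-src = X.exchange-src ; pres-tgt = X.exchange-tgt }

    -- Distinct targets would make src e′ branching towards tgt (Φ₂ e′), where τ Φ₂ = Φ₁.
    targets-match : ∀ {e e′} → src G e′ ≡ src G e → X.exchange (edge (hom Φ₂) e′) ≡ edge (hom Φ₁) e →
                    tgt G e′ ≡ tgt G e
    targets-match {e} {e′} same-src eq with tgt G e′ ≟ tgt G e
    ... | yes same = same
    ... | no differ = contradiction (cong (tgt G) e′≡e) differ
      where
      Σtgt-e′ = sym (edge-tgt-over Φ₂ Φ₂≗ e′)
      Σtgt-e = trans (sym (edge-tgt-over Φ₁ Φ₁≗ e)) (trans (cong (tgt M) (sym eq)) (X.exchange-tgt _))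
      two : TwoInFiber Φ₀ (src G e′) (tgt M (edge (hom Φ₂) e′))
      two = tgt G e′ , tgt G e , differ , (e′ , refl , refl) , (e , sym same-src , refl) , Σtgt-e′ , Σtgt-e
      e′≡e : e′ ≡ e
      e′≡e = local-inj Φ₁ (src G e) e′ e same-src refl (trans (sym (X.exchange-on e′ two)) eq)

    factorisation = P-factor (outBijective-aut τ (outBijective-resp Φ₂≗ (resolver-outBijective Φ₂)))
                             (outBijective-resp Φ₁≗ (resolver-outBijective Φ₁)) targets-match

  -- The junk value K covers edges m that do not start at Σ₀ K.
  liftTarget : V G → E M → V G
  liftTarget K m with src M m ≟ Σ₀ K
  ... | yes p = tgt G (lift Φ₀ K m p)
  ... | no _ = K

  liftTarget-image : ∀ {K e} → src G e ≡ K → liftTarget K (edge (hom Φ₀) e) ≡ tgt G e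
  liftTarget-image {K} {e} se with src M (edge (hom Φ₀) e) ≟ Σ₀ K
  ... | yes p = cong (tgt G) (lift-unique Φ₀ se p)
  ... | no ¬p = contradiction (trans (edge-src (hom Φ₀) e) (cong Σ₀ se)) ¬p

  module TwoBranchingStates
    (factor : ∀ (Φ₁ Φ₂ : RightResolver G M) → ∃[ σ ] ∃[ τ ] EqComp Φ₁ τ Φ₂ σ)
    {x y : V M} {K₁ K₂ : V G} (ΣK₁ : Σ₀ K₁ ≡ x) (ΣK₂ : Σ₀ K₂ ≡ x) (K₁≢K₂ : K₁ ≢ K₂) where

    Arrow : E M → Set
    Arrow m = src M m ≡ x × tgt M m ≡ y

    β₁ β₂ : E M → V G
    β₁ = liftTarget K₁
    β₂ = liftTarget K₂

    separating : ∀ {K} → Σ₀ K ≡ x → TwoInFiber Φ₀ K y → ∃₂ (Separating Arrow (liftTarget K))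
    separating {K} ΣK (J₁ , J₂ , J₁≢J₂ , (e₁ , se₁ , te₁) , (e₂ , se₂ , te₂) , ΣJ₁ , ΣJ₂) =
      edge (hom Φ₀) e₁ , edge (hom Φ₀) e₂ , arrow e₁ se₁ te₁ ΣJ₁ , arrow e₂ se₂ te₂ ΣJ₂ ,
      λ eq → J₁≢J₂ (trans (sym (trans (liftTarget-image se₁) te₁))
                          (trans eq (trans (liftTarget-image se₂) te₂)))
      where
      arrow : ∀ {J} e → src G e ≡ K → tgt G e ≡ J → Σ₀ J ≡ y → Arrow (edge (hom Φ₀) e)
      arrow e se te ΣJ = trans (edge-src (hom Φ₀) e) (trans (cong Σ₀ se) ΣK)
                       , trans (edge-tgt (hom Φ₀) e) (trans (cong Σ₀ te) ΣJ)

    -- Swap the K₁-lifts of a and b and compare with Φ₀: g = τ⁻¹ exchanges the β₁-values of a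
    -- and b and fixes the (β₁, β₂)-values of all other arrows, so no arrow takes over the value
    -- a loses, which is impossible for an injection of a finite set.
    module _ {a b : E M} (arrow-a : Arrow a) (arrow-b : Arrow b)
             (β₁a≢β₁b : β₁ a ≢ β₁ b) (β₂a≢β₂b : β₂ a ≢ β₂ b) where

      private
        lift₁ : ∀ {m} → Arrow m → E G
        lift₁ {m} (sm , _) = lift Φ₀ K₁ m (trans sm (sym ΣK₁))

        ea = lift₁ arrow-a
        eb = lift₁ arrow-b

        lift₁-src : ∀ {m} (arrow-m : Arrow m) → src G (lift₁ arrow-m) ≡ K₁
        lift₁-src {m} (sm , _) = lift-src Φ₀ K₁ m _

        lift₁-edge : ∀ {m} (arrow-m : Arrow m) → edge (hom Φ₀) (lift₁ arrow-m) ≡ m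
        lift₁-edge {m} (sm , _) = lift-edge Φ₀ K₁ m _

        lift₁-tgt : ∀ {m} (arrow-m : Arrow m) → Σ₀ (tgt G (lift₁ arrow-m)) ≡ y
        lift₁-tgt arrow-m = trans (sym (edge-tgt (hom Φ₀) _))
          (trans (cong (tgt M) (lift₁-edge arrow-m)) (proj₂ arrow-m))

        swapped = swapEdges Φ₀ ea eb (trans (lift₁-src arrow-a) (sym (lift₁-src arrow-b)))
                                     (trans (lift₁-tgt arrow-a) (sym (lift₁-tgt arrow-b)))

        σ = proj₁ (factor swapped Φ₀)
        τ = proj₁ (proj₂ (factor swapped Φ₀))
        g = perm (P-inverse τ)

        g-swapped : ∀ e → g (edge (hom Φ₀) (PC.transpose ea eb e)) ≡ edge (hom Φ₀) (perm σ e)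
        g-swapped e = trans (cong g (proj₁ (proj₂ (proj₂ (factor swapped Φ₀))) e)) (inv-l τ _)

        liftTarget-g : ∀ {K e} → src G e ≡ K →
                       liftTarget K (g (edge (hom Φ₀) (PC.transpose ea eb e))) ≡ tgt G e
        liftTarget-g {K} {e} se = trans (cong (liftTarget K) (g-swapped e))
          (trans (liftTarget-image (trans (pres-src σ e) se)) (pres-tgt σ e))

        liftTarget-g-fixed : ∀ {K e} → src G e ≡ K → e ≢ ea → e ≢ eb →
                             liftTarget K (g (edge (hom Φ₀) e)) ≡ liftTarget K (edge (hom Φ₀) e)
        liftTarget-g-fixed {K} {e} se e≢ea e≢eb = trans
          (cong (liftTarget K ∘ g ∘ edge (hom Φ₀)) (sym (transpose-other e≢ea e≢eb)))
          (trans (liftTarget-g se) (sym (liftTarget-image se)))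

        β₂-g : ∀ {m} → Arrow m → β₂ (g m) ≡ β₂ m
        β₂-g {m} (sm , _) = subst (λ m′ → β₂ (g m′) ≡ β₂ m′) (lift-edge Φ₀ K₂ m p)
          (liftTarget-g-fixed se (K₁≢K₂ ∘ off ea (lift₁-src arrow-a)) (K₁≢K₂ ∘ off eb (lift₁-src arrow-b)))
          where
          p = trans sm (sym ΣK₂)
          se = lift-src Φ₀ K₂ m p
          off : ∀ e′ → src G e′ ≡ K₁ → lift Φ₀ K₂ m p ≡ e′ → K₁ ≡ K₂
          off e′ se′ eq = trans (sym se′) (trans (cong (src G) (sym eq)) se)

        β₁-g : ∀ {m} (arrow-m : Arrow m) → m ≢ a → m ≢ b → β₁ (g m) ≡ β₁ m
        β₁-g {m} arrow-m m≢a m≢b = subst (λ m′ → β₁ (g m′) ≡ β₁ m′) (lift₁-edge arrow-m)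
          (liftTarget-g-fixed (lift₁-src arrow-m) (m≢a ∘ off arrow-a) (m≢b ∘ off arrow-b))
          where
          off : ∀ {n} (arrow-n : Arrow n) → lift₁ arrow-m ≡ lift₁ arrow-n → m ≡ n
          off arrow-n eq =
            trans (sym (lift₁-edge arrow-m)) (trans (cong (edge (hom Φ₀)) eq) (lift₁-edge arrow-n))

        β₁-ga : β₁ (g a) ≡ β₁ b
        β₁-ga = begin
          β₁ (g a)                                          ≡⟨ cong (β₁ ∘ g) a≡Φ₀πeb ⟩
          β₁ (g (edge (hom Φ₀) (PC.transpose ea eb eb)))    ≡⟨ liftTarget-g (lift₁-src arrow-b) ⟩
          tgt G eb                                          ≡⟨ liftTarget-image (lift₁-src arrow-b) ⟨
          β₁ (edge (hom Φ₀) eb)                             ≡⟨ cong β₁ (lift₁-edge arrow-b) ⟩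
          β₁ b                                              ∎
          where
          open ≡-Reasoning
          a≡Φ₀πeb = trans (sym (lift₁-edge arrow-a)) (cong (edge (hom Φ₀)) (sym (transpose-matchʳ ea eb)))

        g-arrow : ∀ {m} → Arrow (g m) → Arrow m
        g-arrow {m} (sgm , tgm) = trans (sym (pres-src (P-inverse τ) m)) sgm
                                , trans (sym (pres-tgt (P-inverse τ) m)) tgm

        SameAsA : E M → Set
        SameAsA m = Arrow m × β₁ m ≡ β₁ a × β₂ m ≡ β₂ a

        Z? : ∀ m → Dec (¬ SameAsA m)
        Z? m = ¬? (((src M m ≟ x) ×-dec (tgt M m ≟ y)) ×-dec (β₁ m ≟ β₁ a) ×-dec (β₂ m ≟ β₂ a))

        g-preserves : ∀ m → ¬ SameAsA m → ¬ SameAsA (g m)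
        g-preserves m ¬same (arrow-gm , β₁gm , β₂gm) with m ≟ a | m ≟ b
        ... | yes refl | _ = ¬same (arrow-a , refl , refl)
        ... | no _ | yes refl = β₂a≢β₂b (trans (sym β₂gm) (β₂-g arrow-b))
        ... | no m≢a | no m≢b = ¬same (arrow-m , trans (sym (β₁-g arrow-m m≢a m≢b)) β₁gm
                                               , trans (sym (β₂-g arrow-m)) β₂gm)
          where arrow-m = g-arrow arrow-gm

      absurd : ⊥
      absurd = invariant⇒backward-invariant Z? g (perm-injective (P-inverse τ)) g-preserves a
        (λ (_ , β₁ga , _) → β₁a≢β₁b (trans (sym β₁ga) β₁-ga)) (arrow-a , refl , refl)

  factorisation⇒almostBunchy : (∀ (Φ₁ Φ₂ : RightResolver G M) → ∃[ σ ] ∃[ τ ] EqComp Φ₁ τ Φ₂ σ) →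
                               AlmostBunchy Φ₀
  factorisation⇒almostBunchy factor x y K₁ K₂ ΣK₁ ΣK₂ two₁ two₂ with K₁ ≟ K₂
  ... | yes K₁≡K₂ = K₁≡K₂
  ... | no K₁≢K₂ with separatingBoth _≟_ Arrow β₁ β₂ (separating ΣK₁ two₁) (separating ΣK₂ two₂)
    where open TwoBranchingStates factor ΣK₁ ΣK₂ K₁≢K₂
  ...   | a , b , (arrow-a , arrow-b , β₁a≢β₁b) , β₂a≢β₂b =
          ⊥-elim (TwoBranchingStates.absurd factor ΣK₁ ΣK₂ K₁≢K₂ arrow-a arrow-b β₁a≢β₁b β₂a≢β₂b)

proposition5p5 : (G M : Graph) → IsMinimalResolvent G M → (Φ₀ : RightResolver G M) →
    (AlmostBunchy Φ₀ ⇔ (∀ (Φ₁ Φ₂ : RightResolver G M) →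
        ∃[ σ ] ∃[ τ ] EqComp Φ₁ τ Φ₂ σ))
    × (Bunchy Φ₀ ⇔ (∀ (Φ₁ Φ₂ : RightResolver G M) →
        ∃[ σ ] EqComp₁ Φ₁ Φ₂ σ))
proposition5p5 G M (_ , minimal) Φ₀ =
  mk⇔ (λ almostBunchy Φ₁ Φ₂ → almostBunchy⇒factorisation Φ₀ almostBunchy Φ₁ Φ₂ (agrees Φ₁) (agrees Φ₂))
      (factorisation⇒almostBunchy Φ₀) ,
  mk⇔ (λ bunchy Φ₁ Φ₂ → bunchy⇒factorisation Φ₀ bunchy Φ₁ Φ₂ (agrees Φ₁) (agrees Φ₂))
      (factorisation⇒bunchy Φ₀)
  where
  agrees : ∀ Φ → state (hom Φ) ≗ state (hom Φ₀)
  agrees Φ = minimal⇒unique-stateMap minimal Φ Φ₀
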